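{- Let $\mathbf{V}$ be a vertical weak adhesive HLR category with respect to a stable system of monics $\mathcal{M}$. If pushouts along $\mathcal{M}$-morphisms in $\mathbf{V}$ are stable under pullbacks, then $\mathbf{V}$ is also a horizontal weak adhesive HLR category with respect to $\mathcal{M}$ (and hence a weak adhesive HLR category).
   Context: A stable system of monics is a class $\mathcal{M}$ of monomorphisms containing all isomorphisms, closed under composition, and stable under pullback. Consider a commutative cube whose bottom face is a pushout square $A\to B$, $A\to C$, $B\to D$, $C\to D$ and whose top face is $A'\to B'$, $A'\to C'$, $B'\to D'$, $C'\to D'$, with vertical morphisms $A'\to A$, $B'\to B$, $C'\to C$, $D'\to D$; its back faces are the two vertical faces containing $A'\to A$, its front faces the two containing $D'\to D$. The bottom pushout is a van Kampen square if for every such cube whose back faces are pullbacks: the top face is a pushout if and only if the front faces are pullbacks. A pushout is a vertical weak VK square if this holds for all such cubes whose four vertical morphisms are in $\mathcal{M}$. $\mathbf{V}$ is a vertical weak adhesive HLR category w.r.t. $\mathcal{M}$ if (V-i) pullbacks along $\mathcal{M}$-morphisms exist (pullbacks of cospans with one leg in $\mathcal{M}$), (V-ii) pushouts along $\mathcal{M}$-morphisms exist (pushouts of spans with one leg in $\mathcal{M}$) and the pushout of an $\mathcal{M}$-morphism along any morphism is in $\mathcal{M}$, (V-iii) every pushout along an $\mathcal{M}$-morphism is a vertical weak VK square. $\mathbf{V}$ is a horizontal weak adhesive HLR category w.r.t. $\mathcal{M}$ if it satisfies (V-i), (V-ii) and (H-iii): every pushout of a span of $\mathcal{M}$-morphisms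 (all four of whose morphisms are then in $\mathcal{M}$) is a van Kampen square. A weak adhesive HLR category is one that is both. Pushouts along $\mathcal{M}$-morphisms are stable under pullbacks if for every commutative cube whose bottom face is a pushout of a span with one leg in $\mathcal{M}$ and whose four vertical faces are pullbacks (vertical morphisms arbitrary), the top face is a pushout. -}

module Defs where

open import Level using (Level; _⊔_) renaming (suc to lsuc)
open import Data.Product using (Σ; _×_; _,_)
open import Data.Sum using (_⊎_)
open import Relation.Binary using (IsEquivalence)

record Category (o ℓ e : Level) : Set (lsuc (o ⊔ ℓ ⊔ e)) where
  infixr 9 _∘_
  infix 4 _≈_
  field
    Obj : Set o
    _⇒_ : Obj → Obj → Set ℓ
    _≈_ : ∀ {A B} → A ⇒ B → A ⇒ B → Set e
    id : ∀ {A} → A ⇒ A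
    _∘_ : ∀ {A B C} → B ⇒ C → A ⇒ B → A ⇒ C
    ≈-equiv : ∀ {A B} → IsEquivalence (_≈_ {A} {B})
    ∘-resp-≈ : ∀ {A B C} {f h : B ⇒ C} {g i : A ⇒ B} → f ≈ h → g ≈ i → f ∘ g ≈ h ∘ i
    assoc : ∀ {A B C D} {f : A ⇒ B} {g : B ⇒ C} {h : C ⇒ D} → (h ∘ g) ∘ f ≈ h ∘ (g ∘ f)
    identityˡ : ∀ {A B} {f : A ⇒ B} → id ∘ f ≈ f
    identityʳ : ∀ {A B} {f : A ⇒ B} → f ∘ id ≈ f

_⇔_ : ∀ {a b} → Set a → Set b → Set (a ⊔ b)
P ⇔ Q = (P → Q) × (Q → P)

module _ {o ℓ e : Level} (𝒞 : Category o ℓ e) where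
  open Category 𝒞

  Mono : ∀ {A B} → A ⇒ B → Set (o ⊔ ℓ ⊔ e)
  Mono {A} f = ∀ {X} (g h : X ⇒ A) → f ∘ g ≈ f ∘ h → g ≈ h

  Iso : ∀ {A B} → A ⇒ B → Set (ℓ ⊔ e)
  Iso {A} {B} f = Σ (B ⇒ A) λ g → (g ∘ f ≈ id) × (f ∘ g ≈ id)

  IsPullback : ∀ {P A B C} → P ⇒ A → P ⇒ B → A ⇒ C → B ⇒ C → Set (o ⊔ ℓ ⊔ e)
  IsPullback {P} {A} {B} p₁ p₂ f g =
    (f ∘ p₁ ≈ g ∘ p₂) ×
    (∀ {X} (x : X ⇒ A) (y : X ⇒ B) → f ∘ x ≈ g ∘ y →
       Σ (X ⇒ P) λ u → (p₁ ∘ u ≈ x) × (p₂ ∘ u ≈ y) ×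
         (∀ (v : X ⇒ P) → p₁ ∘ v ≈ x → p₂ ∘ v ≈ y → v ≈ u))

  IsPushout : ∀ {A B C Q} → A ⇒ B → A ⇒ C → B ⇒ Q → C ⇒ Q → Set (o ⊔ ℓ ⊔ e)
  IsPushout {A} {B} {C} {Q} f g i₁ i₂ =
    (i₁ ∘ f ≈ i₂ ∘ g) ×
    (∀ {X} (x : B ⇒ X) (y : C ⇒ X) → x ∘ f ≈ y ∘ g →
       Σ (Q ⇒ X) λ u → (u ∘ i₁ ≈ x) × (u ∘ i₂ ≈ y) ×
         (∀ (v : Q ⇒ X) → v ∘ i₁ ≈ x → v ∘ i₂ ≈ y → v ≈ u))

  MorClass : (m : Level) → Set (o ⊔ ℓ ⊔ lsuc m)
  MorClass m = ∀ {A B} → A ⇒ B → Set m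

  record StableSystemOfMonics {m} (M : MorClass m) : Set (o ⊔ ℓ ⊔ e ⊔ m) where
    field
      monic : ∀ {A B} {f : A ⇒ B} → M f → Mono f
      iso : ∀ {A B} {f : A ⇒ B} → Iso f → M f
      comp : ∀ {A B C} {f : A ⇒ B} {g : B ⇒ C} → M f → M g → M (g ∘ f)
      pullback-stable : ∀ {P A B C} {p₁ : P ⇒ A} {p₂ : P ⇒ B} {f : A ⇒ C} {g : B ⇒ C} →
                        IsPullback p₁ p₂ f g → M g → M p₁

  record Cube {A B C D : Obj} (f : A ⇒ B) (g : A ⇒ C) (h : B ⇒ D) (k : C ⇒ D)
              : Set (o ⊔ ℓ ⊔ e) where
    field
      A' B' C' D' : Obj
      f' : A' ⇒ B'
      g' : A' ⇒ C'
      h' : B' ⇒ D'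
      k' : C' ⇒ D'
      a : A' ⇒ A
      b : B' ⇒ B
      c : C' ⇒ C
      d : D' ⇒ D
      top-comm : h' ∘ f' ≈ k' ∘ g'
      back-B-comm : b ∘ f' ≈ f ∘ a
      back-C-comm : c ∘ g' ≈ g ∘ a
      front-B-comm : d ∘ h' ≈ h ∘ b
      front-C-comm : d ∘ k' ≈ k ∘ c

    BackPullbacks : Set (o ⊔ ℓ ⊔ e)
    BackPullbacks = IsPullback f' a b f × IsPullback g' a c g

    FrontPullbacks : Set (o ⊔ ℓ ⊔ e)
    FrontPullbacks = IsPullback h' b d h × IsPullback k' c d k

    TopPushout : Set (o ⊔ ℓ ⊔ e)
    TopPushout = IsPushout f' g' h' k'

  IsVK : ∀ {A B C D} → A ⇒ B → A ⇒ C → B ⇒ D → C ⇒ D → Set (o ⊔ ℓ ⊔ e)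
  IsVK f g h k =
    IsPushout f g h k ×
    (∀ (Q : Cube f g h k) → Cube.BackPullbacks Q →
       Cube.TopPushout Q ⇔ Cube.FrontPullbacks Q)

  IsVerticalWeakVK : ∀ {m} → MorClass m →
                     ∀ {A B C D} → A ⇒ B → A ⇒ C → B ⇒ D → C ⇒ D → Set (o ⊔ ℓ ⊔ e ⊔ m)
  IsVerticalWeakVK M f g h k =
    IsPushout f g h k ×
    (∀ (Q : Cube f g h k) →
       M (Cube.a Q) → M (Cube.b Q) → M (Cube.c Q) → M (Cube.d Q) →
       Cube.BackPullbacks Q →
       Cube.TopPushout Q ⇔ Cube.FrontPullbacks Q)

  record HLRBase {m} (M : MorClass m) : Set (o ⊔ ℓ ⊔ e ⊔ m) where
    field
      pullback-along-M : ∀ {A B C} (f : A ⇒ C) (g : B ⇒ C) → M f ⊎ M g →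
        Σ Obj λ P → Σ (P ⇒ A) λ p₁ → Σ (P ⇒ B) λ p₂ → IsPullback p₁ p₂ f g
      pushout-along-M : ∀ {A B C} (f : A ⇒ B) (g : A ⇒ C) → M f ⊎ M g →
        Σ Obj λ Q → Σ (B ⇒ Q) λ i₁ → Σ (C ⇒ Q) λ i₂ → IsPushout f g i₁ i₂
      pushout-preserves-M : ∀ {A B C D} {f : A ⇒ B} {g : A ⇒ C} {h : B ⇒ D} {k : C ⇒ D} →
        IsPushout f g h k → M f → M k

  record VerticalWeakAdhesiveHLR {m} (M : MorClass m) : Set (o ⊔ ℓ ⊔ e ⊔ m) where
    field
      base : HLRBase M
      vertical-weak-VK : ∀ {A B C D} {f : A ⇒ B} {g : A ⇒ C} {h : B ⇒ D} {k : C ⇒ D} →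
        IsPushout f g h k → M f ⊎ M g → IsVerticalWeakVK M f g h k

  record HorizontalWeakAdhesiveHLR {m} (M : MorClass m) : Set (o ⊔ ℓ ⊔ e ⊔ m) where
    field
      base : HLRBase M
      horizontal-VK : ∀ {A B C D} {f : A ⇒ B} {g : A ⇒ C} {h : B ⇒ D} {k : C ⇒ D} →
        IsPushout f g h k → M f → M g → IsVK f g h k

  WeakAdhesiveHLR : ∀ {m} → MorClass m → Set (o ⊔ ℓ ⊔ e ⊔ m)
  WeakAdhesiveHLR M = VerticalWeakAdhesiveHLR M × HorizontalWeakAdhesiveHLR M

  PushoutsAlongMStableUnderPullbacks : ∀ {m} → MorClass m → Set (o ⊔ ℓ ⊔ e ⊔ m)
  PushoutsAlongMStableUnderPullbacks M =
    ∀ {A B C D} {f : A ⇒ B} {g : A ⇒ C} {h : B ⇒ D} {k : C ⇒ D} →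
      IsPushout f g h k → M f ⊎ M g →
      ∀ (Q : Cube f g h k) → Cube.BackPullbacks Q → Cube.FrontPullbacks Q →
      Cube.TopPushout Q

{-# OPTIONS --safe #-}
module Submission where

-- The "if" half of the van Kampen property is precisely stability of pushouts
-- under pullback.  For "only if", pull the bottom pushout back along d : D' → D;
-- by stability this yields a pushout over D' all of whose vertical faces are
-- pullbacks.  The given cube factors through it by a comparison cube with
-- d = id, whose vertical morphisms are in M since they factor M-morphisms
-- through monos.  Its back faces are pullbacks by cancellation, so vertical
-- weak VK of the pulled-back pushout makes its front faces pullbacks, and
-- pasting these onto the pulled-back front faces gives the claim.

open import Level using (Level; _⊔_)
open import Data.Product using (_×_; _,_; proj₁; proj₂)
open import Data.Sum using (inj₁; inj₂)
open import Relation.Binary using (Setoid; IsEquivalence)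
import Relation.Binary.Reasoning.Setoid as SetoidReasoning
open import Defs

module CategoryProperties {o ℓ e : Level} (𝒞 : Category o ℓ e) where
  open Category 𝒞

  hom-setoid : ∀ {A B} → Setoid ℓ e
  hom-setoid {A} {B} = record { Carrier = A ⇒ B ; _≈_ = _≈_ ; isEquivalence = ≈-equiv }

  module ≈ {A B : Obj} = IsEquivalence (≈-equiv {A} {B})
  module HomReasoning {A B : Obj} = SetoidReasoning (hom-setoid {A} {B})
  open HomReasoning

  ∘-resp-≈ˡ : ∀ {A B C} {f h : B ⇒ C} {g : A ⇒ B} → f ≈ h → f ∘ g ≈ h ∘ g
  ∘-resp-≈ˡ f≈h = ∘-resp-≈ f≈h ≈.refl

  ∘-resp-≈ʳ : ∀ {A B C} {f : B ⇒ C} {g i : A ⇒ B} → g ≈ i → f ∘ g ≈ f ∘ i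
  ∘-resp-≈ʳ g≈i = ∘-resp-≈ ≈.refl g≈i

  pullˡ : ∀ {X A B C} {f : B ⇒ C} {g : A ⇒ B} {h : A ⇒ C} {x : X ⇒ A} →
          f ∘ g ≈ h → f ∘ (g ∘ x) ≈ h ∘ x
  pullˡ fg≈h = ≈.trans (≈.sym assoc) (∘-resp-≈ˡ fg≈h)

  extendʳ : ∀ {X P A B C} {p₁ : P ⇒ A} {p₂ : P ⇒ B} {f : A ⇒ C} {g : B ⇒ C} {x : X ⇒ P} →
            f ∘ p₁ ≈ g ∘ p₂ → f ∘ (p₁ ∘ x) ≈ g ∘ (p₂ ∘ x)
  extendʳ fp₁≈gp₂ = ≈.trans (pullˡ fp₁≈gp₂) assoc

  glue : ∀ {P A B C E F} {p₁ : P ⇒ A} {p₂ : P ⇒ B} {f : A ⇒ C} {g : B ⇒ C}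
           {q : A ⇒ E} {s : E ⇒ F} {t : C ⇒ F} →
         s ∘ q ≈ t ∘ f → f ∘ p₁ ≈ g ∘ p₂ → s ∘ (q ∘ p₁) ≈ (t ∘ g) ∘ p₂
  glue sq≈tf fp₁≈gp₂ = ≈.trans (extendʳ sq≈tf) (≈.trans (∘-resp-≈ʳ fp₁≈gp₂) (≈.sym assoc))

  module _ {P A B C} {p₁ : P ⇒ A} {p₂ : P ⇒ B} {f : A ⇒ C} {g : B ⇒ C}
           (pb : IsPullback 𝒞 p₁ p₂ f g) where

    module _ {X} {x : X ⇒ A} {y : X ⇒ B} (eq : f ∘ x ≈ g ∘ y) where

      universal : X ⇒ P
      universal = proj₁ (proj₂ pb x y eq)

      p₁∘universal : p₁ ∘ universal ≈ x
      p₁∘universal = proj₁ (proj₂ (proj₂ pb x y eq))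

      p₂∘universal : p₂ ∘ universal ≈ y
      p₂∘universal = proj₁ (proj₂ (proj₂ (proj₂ pb x y eq)))

      universal-unique : (v : X ⇒ P) → p₁ ∘ v ≈ x → p₂ ∘ v ≈ y → v ≈ universal
      universal-unique = proj₂ (proj₂ (proj₂ (proj₂ pb x y eq)))

    pullback-jointly-monic : ∀ {X} (u v : X ⇒ P) →
                             p₁ ∘ u ≈ p₁ ∘ v → p₂ ∘ u ≈ p₂ ∘ v → u ≈ v
    pullback-jointly-monic u v p₁u≈p₁v p₂u≈p₂v =
      ≈.trans (universal-unique eq u p₁u≈p₁v p₂u≈p₂v) (≈.sym (universal-unique eq v ≈.refl ≈.refl))
      where
      eq : f ∘ (p₁ ∘ v) ≈ g ∘ (p₂ ∘ v)
      eq = extendʳ (proj₁ pb)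

  pullback-swap : ∀ {P A B C} {p₁ : P ⇒ A} {p₂ : P ⇒ B} {f : A ⇒ C} {g : B ⇒ C} →
                  IsPullback 𝒞 p₁ p₂ f g → IsPullback 𝒞 p₂ p₁ g f
  pullback-swap pb = ≈.sym (proj₁ pb) , λ x y eq →
    universal pb (≈.sym eq) , p₂∘universal pb (≈.sym eq) , p₁∘universal pb (≈.sym eq) ,
    λ v p₂v≈x p₁v≈y → universal-unique pb (≈.sym eq) v p₁v≈y p₂v≈x

  pushout-swap : ∀ {A B C Q} {f : A ⇒ B} {g : A ⇒ C} {i₁ : B ⇒ Q} {i₂ : C ⇒ Q} →
                 IsPushout 𝒞 f g i₁ i₂ → IsPushout 𝒞 g f i₂ i₁
  pushout-swap (commutes , factor) = ≈.sym commutes , λ x y eq →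
    let (u , ui₁≈y , ui₂≈x , unique) = factor y x (≈.sym eq)
    in u , ui₂≈x , ui₁≈y , λ v vi₂≈x vi₁≈y → unique v vi₁≈y vi₂≈x

  pullback-resp-≈ : ∀ {P A B C} {p₁ p₁′ : P ⇒ A} {p₂ p₂′ : P ⇒ B} {f f′ : A ⇒ C} {g g′ : B ⇒ C} →
                    IsPullback 𝒞 p₁ p₂ f g →
                    p₁ ≈ p₁′ → p₂ ≈ p₂′ → f ≈ f′ → g ≈ g′ → IsPullback 𝒞 p₁′ p₂′ f′ g′
  pullback-resp-≈ pb p₁≈ p₂≈ f≈ g≈ =
    ≈.trans (∘-resp-≈ (≈.sym f≈) (≈.sym p₁≈)) (≈.trans (proj₁ pb) (∘-resp-≈ g≈ p₂≈)) ,
    λ x y eq →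
      let eq′ = ≈.trans (∘-resp-≈ˡ f≈) (≈.trans eq (∘-resp-≈ˡ (≈.sym g≈)))
      in universal pb eq′ ,
         ≈.trans (∘-resp-≈ˡ (≈.sym p₁≈)) (p₁∘universal pb eq′) ,
         ≈.trans (∘-resp-≈ˡ (≈.sym p₂≈)) (p₂∘universal pb eq′) ,
         λ v p₁′v≈x p₂′v≈y →
           universal-unique pb eq′ v (≈.trans (∘-resp-≈ˡ p₁≈) p₁′v≈x) (≈.trans (∘-resp-≈ˡ p₂≈) p₂′v≈y)

  pullback-paste : ∀ {P A B C E F} {p₁ : P ⇒ A} {p₂ : P ⇒ B} {f : A ⇒ C} {g : B ⇒ C}
                     {q : A ⇒ E} {s : E ⇒ F} {t : C ⇒ F} →
                   IsPullback 𝒞 p₁ p₂ f g → IsPullback 𝒞 q f s t →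
                   IsPullback 𝒞 (q ∘ p₁) p₂ s (t ∘ g)
  pullback-paste {p₁ = p₁} {f = f} {g} {q} {s} {t} pb₁ pb₂ = glue (proj₁ pb₂) (proj₁ pb₁) , λ x y eq →
    let w-eq : s ∘ x ≈ t ∘ (g ∘ y)
        w-eq = ≈.trans eq assoc
        u-eq : f ∘ universal pb₂ w-eq ≈ g ∘ y
        u-eq = p₂∘universal pb₂ w-eq
    in universal pb₁ u-eq ,
       (begin
         (q ∘ p₁) ∘ universal pb₁ u-eq ≈⟨ assoc ⟩
         q ∘ (p₁ ∘ universal pb₁ u-eq) ≈⟨ ∘-resp-≈ʳ (p₁∘universal pb₁ u-eq) ⟩
         q ∘ universal pb₂ w-eq        ≈⟨ p₁∘universal pb₂ w-eq ⟩
         x                             ∎) ,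
       p₂∘universal pb₁ u-eq ,
       λ v qp₁v≈x p₂v≈y →
         universal-unique pb₁ u-eq v
           (universal-unique pb₂ w-eq (p₁ ∘ v) (≈.trans (≈.sym assoc) qp₁v≈x)
              (≈.trans (extendʳ (proj₁ pb₁)) (∘-resp-≈ʳ p₂v≈y)))
           p₂v≈y

  pullback-cancel : ∀ {P A B C E F} {p₁ : P ⇒ A} {p₂ : P ⇒ B} {f : A ⇒ C} {g : B ⇒ C}
                      {q : A ⇒ E} {s : E ⇒ F} {t : C ⇒ F} →
                    IsPullback 𝒞 q f s t → IsPullback 𝒞 (q ∘ p₁) p₂ s (t ∘ g) →
                    f ∘ p₁ ≈ g ∘ p₂ → IsPullback 𝒞 p₁ p₂ f g
  pullback-cancel {p₁ = p₁} {p₂} {f} {g} {q} pb₂ pb commutes = commutes , λ x y eq →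
    let qx-eq = glue {q = q} (proj₁ pb₂) eq
        u = universal pb qx-eq
    in u ,
       pullback-jointly-monic pb₂ (p₁ ∘ u) x
         (≈.trans (≈.sym assoc) (p₁∘universal pb qx-eq))
         (begin
           f ∘ (p₁ ∘ u) ≈⟨ extendʳ commutes ⟩
           g ∘ (p₂ ∘ u) ≈⟨ ∘-resp-≈ʳ (p₂∘universal pb qx-eq) ⟩
           g ∘ y        ≈⟨ eq ⟨
           f ∘ x        ∎) ,
       p₂∘universal pb qx-eq ,
       λ v p₁v≈x p₂v≈y → universal-unique pb qx-eq v (≈.trans assoc (∘-resp-≈ʳ p₁v≈x)) p₂v≈y

  pullback-pasteᵛ : ∀ {P A B C E F} {p₁ : P ⇒ A} {p₂ : P ⇒ B} {f : A ⇒ C} {g : B ⇒ C}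
                      {q : B ⇒ E} {s : C ⇒ F} {t : E ⇒ F} →
                    IsPullback 𝒞 p₁ p₂ f g → IsPullback 𝒞 g q s t →
                    IsPullback 𝒞 p₁ (q ∘ p₂) (s ∘ f) t
  pullback-pasteᵛ pb₁ pb₂ = pullback-swap (pullback-paste (pullback-swap pb₁) (pullback-swap pb₂))

  pullback-cancelᵛ : ∀ {P A B C E F} {p₁ : P ⇒ A} {p₂ : P ⇒ B} {f : A ⇒ C} {g : B ⇒ C}
                       {q : B ⇒ E} {s : C ⇒ F} {t : E ⇒ F} →
                     IsPullback 𝒞 g q s t → IsPullback 𝒞 p₁ (q ∘ p₂) (s ∘ f) t →
                     f ∘ p₁ ≈ g ∘ p₂ → IsPullback 𝒞 p₁ p₂ f g
  pullback-cancelᵛ pb₂ pb commutes =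
    pullback-swap (pullback-cancel (pullback-swap pb₂) (pullback-swap pb) (≈.sym commutes))

  mono-pullback : ∀ {A B C} {u : A ⇒ C} {x : B ⇒ A} {n : B ⇒ C} →
                  Mono 𝒞 u → u ∘ x ≈ n → IsPullback 𝒞 x id u n
  mono-pullback mono ux≈n = ≈.trans ux≈n (≈.sym identityʳ) , λ y z eq →
    z , mono _ y (≈.trans (pullˡ ux≈n) (≈.sym eq)) , identityˡ ,
    λ v _ idv≈z → ≈.trans (≈.sym identityˡ) idv≈z

  record Pullback {A B C} (f : A ⇒ C) (g : B ⇒ C) : Set (o ⊔ ℓ ⊔ e) where
    field
      P : Obj
      p₁ : P ⇒ A
      p₂ : P ⇒ B
      isPullback : IsPullback 𝒞 p₁ p₂ f g

  back-B-pullback⇒back-C-pullback :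
    ∀ {A B C D} {f : A ⇒ B} {g : A ⇒ C} {h : B ⇒ D} {k : C ⇒ D} →
    h ∘ f ≈ k ∘ g → (Q : Cube 𝒞 f g h k) → Cube.FrontPullbacks Q →
    IsPullback 𝒞 (Cube.f' Q) (Cube.a Q) (Cube.b Q) f →
    IsPullback 𝒞 (Cube.g' Q) (Cube.a Q) (Cube.c Q) g
  back-B-pullback⇒back-C-pullback hf≈kg Q (front-B , front-C) back-B =
    pullback-cancel front-C
      (pullback-resp-≈ (pullback-paste back-B front-B) top-comm ≈.refl ≈.refl hf≈kg)
      back-C-comm
    where open Cube Q

module StableSystemProperties {o ℓ e m} {𝒞 : Category o ℓ e} {M : MorClass 𝒞 m}
                              (S : StableSystemOfMonics 𝒞 M) where
  open Category 𝒞
  open CategoryProperties 𝒞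
  open StableSystemOfMonics S

  M-id : ∀ {A} → M (id {A})
  M-id = iso (id , identityˡ , identityˡ)

  M-cancelˡ : ∀ {A B C} {u : A ⇒ C} {x : B ⇒ A} {n : B ⇒ C} →
              Mono 𝒞 u → u ∘ x ≈ n → M n → M x
  M-cancelˡ mono ux≈n Mn = pullback-stable (mono-pullback mono ux≈n) Mn

module HorizontalFromVertical {o ℓ e m} {𝒞 : Category o ℓ e} {M : MorClass 𝒞 m}
  (S : StableSystemOfMonics 𝒞 M) (V : VerticalWeakAdhesiveHLR 𝒞 M)
  (stable : PushoutsAlongMStableUnderPullbacks 𝒞 M) where

  open Category 𝒞
  open CategoryProperties 𝒞
  open HomReasoning
  open StableSystemOfMonics S
  open StableSystemProperties S
  open VerticalWeakAdhesiveHLR V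
  open HLRBase base

  pullback-alongʳ : ∀ {A B C} (f : A ⇒ C) (g : B ⇒ C) → M g → Pullback f g
  pullback-alongʳ f g Mg =
    let (P , p₁ , p₂ , pb) = pullback-along-M f g (inj₂ Mg)
    in record { P = P ; p₁ = p₁ ; p₂ = p₂ ; isPullback = pb }

  module _ {A B C D} {f : A ⇒ B} {g : A ⇒ C} {h : B ⇒ D} {k : C ⇒ D}
           (po : IsPushout 𝒞 f g h k) (Mf : M f) (Mg : M g) where

    Mh : M h
    Mh = pushout-preserves-M (pushout-swap po) Mg

    Mk : M k
    Mk = pushout-preserves-M po Mf

    module PulledBack {D'} (d : D' ⇒ D) where
      open Pullback (pullback-alongʳ d h Mh) public
        renaming (P to Bᵈ; p₁ to hᵈ; p₂ to bᵈ; isPullback to front-Bᵈ)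
      open Pullback (pullback-alongʳ d k Mk) public
        renaming (P to Cᵈ; p₁ to kᵈ; p₂ to cᵈ; isPullback to front-Cᵈ)
      open Pullback (pullback-alongʳ bᵈ f Mf) public
        renaming (P to Aᵈ; p₁ to fᵈ; p₂ to aᵈ; isPullback to back-Bᵈ)

      gᵈ-eq : d ∘ (hᵈ ∘ fᵈ) ≈ k ∘ (g ∘ aᵈ)
      gᵈ-eq = ≈.trans (glue (proj₁ front-Bᵈ) (proj₁ back-Bᵈ))
                      (≈.trans (∘-resp-≈ˡ (proj₁ po)) assoc)

      gᵈ : Aᵈ ⇒ Cᵈ
      gᵈ = universal front-Cᵈ gᵈ-eq

      cubeᵈ : Cube 𝒞 f g h k
      cubeᵈ = record
        { f' = fᵈ ; g' = gᵈ ; h' = hᵈ ; k' = kᵈ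
        ; a = aᵈ ; b = bᵈ ; c = cᵈ ; d = d
        ; top-comm = ≈.sym (p₁∘universal front-Cᵈ gᵈ-eq)
        ; back-B-comm = proj₁ back-Bᵈ
        ; back-C-comm = p₂∘universal front-Cᵈ gᵈ-eq
        ; front-B-comm = proj₁ front-Bᵈ
        ; front-C-comm = proj₁ front-Cᵈ
        }

      back-Cᵈ : IsPullback 𝒞 gᵈ aᵈ cᵈ g
      back-Cᵈ = back-B-pullback⇒back-C-pullback (proj₁ po) cubeᵈ (front-Bᵈ , front-Cᵈ) back-Bᵈ

      top-pushoutᵈ : IsPushout 𝒞 fᵈ gᵈ hᵈ kᵈ
      top-pushoutᵈ = stable po (inj₁ Mf) cubeᵈ (back-Bᵈ , back-Cᵈ) (front-Bᵈ , front-Cᵈ)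

    module Comparison (Q : Cube 𝒞 f g h k) where
      open Cube Q
      open PulledBack d

      β : B' ⇒ Bᵈ
      β = universal front-Bᵈ front-B-comm

      hᵈ∘β≈h' : hᵈ ∘ β ≈ h'
      hᵈ∘β≈h' = p₁∘universal front-Bᵈ front-B-comm

      bᵈ∘β≈b : bᵈ ∘ β ≈ b
      bᵈ∘β≈b = p₂∘universal front-Bᵈ front-B-comm

      γ : C' ⇒ Cᵈ
      γ = universal front-Cᵈ front-C-comm

      kᵈ∘γ≈k' : kᵈ ∘ γ ≈ k'
      kᵈ∘γ≈k' = p₁∘universal front-Cᵈ front-C-comm

      cᵈ∘γ≈c : cᵈ ∘ γ ≈ c
      cᵈ∘γ≈c = p₂∘universal front-Cᵈ front-C-comm

      α-eq : bᵈ ∘ (β ∘ f') ≈ f ∘ a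
      α-eq = ≈.trans (pullˡ bᵈ∘β≈b) back-B-comm

      α : A' ⇒ Aᵈ
      α = universal back-Bᵈ α-eq

      fᵈ∘α≈β∘f' : fᵈ ∘ α ≈ β ∘ f'
      fᵈ∘α≈β∘f' = p₁∘universal back-Bᵈ α-eq

      aᵈ∘α≈a : aᵈ ∘ α ≈ a
      aᵈ∘α≈a = p₂∘universal back-Bᵈ α-eq

      γ∘g'≈gᵈ∘α : γ ∘ g' ≈ gᵈ ∘ α
      γ∘g'≈gᵈ∘α = pullback-jointly-monic front-Cᵈ (γ ∘ g') (gᵈ ∘ α)
        (begin
          kᵈ ∘ (γ ∘ g') ≈⟨ pullˡ kᵈ∘γ≈k' ⟩
          k' ∘ g'       ≈⟨ top-comm ⟨
          h' ∘ f'       ≈⟨ pullˡ hᵈ∘β≈h' ⟨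
          hᵈ ∘ (β ∘ f') ≈⟨ ∘-resp-≈ʳ fᵈ∘α≈β∘f' ⟨
          hᵈ ∘ (fᵈ ∘ α) ≈⟨ extendʳ (Cube.top-comm cubeᵈ) ⟩
          kᵈ ∘ (gᵈ ∘ α) ∎)
        (begin
          cᵈ ∘ (γ ∘ g') ≈⟨ pullˡ cᵈ∘γ≈c ⟩
          c ∘ g'        ≈⟨ back-C-comm ⟩
          g ∘ a         ≈⟨ ∘-resp-≈ʳ aᵈ∘α≈a ⟨
          g ∘ (aᵈ ∘ α)  ≈⟨ extendʳ (Cube.back-C-comm cubeᵈ) ⟨
          cᵈ ∘ (gᵈ ∘ α) ∎)

      comparison : Cube 𝒞 fᵈ gᵈ hᵈ kᵈ
      comparison = record
        { f' = f' ; g' = g' ; h' = h' ; k' = k'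
        ; a = α ; b = β ; c = γ ; d = id
        ; top-comm = top-comm
        ; back-B-comm = ≈.sym fᵈ∘α≈β∘f'
        ; back-C-comm = γ∘g'≈gᵈ∘α
        ; front-B-comm = ≈.trans identityˡ (≈.sym hᵈ∘β≈h')
        ; front-C-comm = ≈.trans identityˡ (≈.sym kᵈ∘γ≈k')
        }

      comparison-back-pullbacks : BackPullbacks → Cube.BackPullbacks comparison
      comparison-back-pullbacks (back-B , back-C) =
        pullback-cancelᵛ back-Bᵈ
          (pullback-resp-≈ back-B ≈.refl (≈.sym aᵈ∘α≈a) (≈.sym bᵈ∘β≈b) ≈.refl)
          (≈.sym fᵈ∘α≈β∘f') ,
        pullback-cancelᵛ back-Cᵈ
          (pullback-resp-≈ back-C ≈.refl (≈.sym aᵈ∘α≈a) (≈.sym cᵈ∘γ≈c) ≈.refl)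
          γ∘g'≈gᵈ∘α

    front-pullbacks : (Q : Cube 𝒞 f g h k) →
                      Cube.BackPullbacks Q → Cube.TopPushout Q → Cube.FrontPullbacks Q
    front-pullbacks Q back@(back-B , back-C) top =
      pullback-resp-≈ (pullback-pasteᵛ (proj₁ comparison-front) front-Bᵈ) ≈.refl bᵈ∘β≈b identityʳ ≈.refl ,
      pullback-resp-≈ (pullback-pasteᵛ (proj₂ comparison-front) front-Cᵈ) ≈.refl cᵈ∘γ≈c identityʳ ≈.refl
      where
      open Cube Q
      open PulledBack d
      open Comparison Q

      Mf' : M f'
      Mf' = pullback-stable back-B Mf

      Mg' : M g'
      Mg' = pullback-stable back-C Mg

      Mβ : M β
      Mβ = M-cancelˡ (monic (pullback-stable front-Bᵈ Mh)) hᵈ∘β≈h'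
                     (pushout-preserves-M (pushout-swap top) Mg')

      Mγ : M γ
      Mγ = M-cancelˡ (monic (pullback-stable front-Cᵈ Mk)) kᵈ∘γ≈k'
                     (pushout-preserves-M top Mf')

      Mα : M α
      Mα = M-cancelˡ (monic (pullback-stable back-Bᵈ Mf)) fᵈ∘α≈β∘f' (comp Mf' Mβ)

      comparison-front : Cube.FrontPullbacks comparison
      comparison-front =
        proj₁ (proj₂ (vertical-weak-VK top-pushoutᵈ (inj₁ (pullback-stable back-Bᵈ Mf)))
                comparison Mα Mβ Mγ M-id (comparison-back-pullbacks back))
              top

  horizontal : HorizontalWeakAdhesiveHLR 𝒞 M
  horizontal = record
    { base = base
    ; horizontal-VK = λ po Mf Mg → po , λ Q back →
        front-pullbacks po Mf Mg Q back , stable po (inj₁ Mf) Q back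
    }

lemma7 : ∀ {o ℓ e m : Level} (𝒞 : Category o ℓ e) (M : MorClass 𝒞 m) →
         StableSystemOfMonics 𝒞 M →
         VerticalWeakAdhesiveHLR 𝒞 M →
         PushoutsAlongMStableUnderPullbacks 𝒞 M →
         HorizontalWeakAdhesiveHLR 𝒞 M × WeakAdhesiveHLR 𝒞 M
lemma7 𝒞 M S V stable = horizontal , V , horizontal
  where open HorizontalFromVertical S V stable
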